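{- Let $k\geq 1$ and $n$ be positive integers with $2k-1\leq n$. Let $\mathcal{A}$ be a family of $(k-1)$-element subsets of $[n]=\{1,\dots,n\}$, and let $\mathcal{B}$ be a family of $k$-element subsets of $[n]$. Suppose that $\mathcal{A}$ and $\mathcal{B}$ are cross-intersecting, that $\mathcal{B}$ is nonempty, and that $\partial\mathcal{B}\subseteq\mathcal{A}$. Then \[ |\mathcal{A}|+|\mathcal{B}|\leq \binom{n}{k-1}-\binom{n-k}{k-1}+1. \]
   Context: Two set families $\mathcal{A}$ and $\mathcal{B}$ are cross-intersecting if $A\cap B\neq\emptyset$ for every $A\in\mathcal{A}$ and $B\in\mathcal{B}$. The shadow $\partial B$ of a $k$-element set $B$ is the family of all $(k-1)$-element subsets of $B$; the shadow $\partial\mathcal{B}$ of a family $\mathcal{B}$ of $k$-element sets is the union of the shadows of its members. -}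

module Defs where

open import Data.Nat using (ℕ; suc)
open import Data.List using (List; length)
open import Data.List.Relation.Unary.Unique.Propositional using (Unique)
open import Data.List.Relation.Unary.Any using (Any)
import Data.List.Membership.Propositional as LM
open import Data.Fin.Subset using (Subset; _⊆_; _∩_; ∣_∣; Nonempty)
open import Relation.Binary.PropositionalEquality using (_≡_)

record Family (n : ℕ) : Set where
  constructor family
  field
    members : List (Subset n)
    unique  : Unique members
open Family public

_∈F_ : ∀ {n} → Subset n → Family n → Set
S ∈F 𝒜 = S LM.∈ members 𝒜

size : ∀ {n} → Family n → ℕ
size 𝒜 = length (members 𝒜)

Uniform : ∀ {n} → ℕ → Family n → Set
Uniform r 𝒜 = ∀ {S} → S ∈F 𝒜 → ∣ S ∣ ≡ r

CrossIntersecting : ∀ {n} → Family n → Family n → Set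
CrossIntersecting 𝒜 ℬ = ∀ {A B} → A ∈F 𝒜 → B ∈F ℬ → Nonempty (A ∩ B)

-- ∂ℬ ⊆ 𝒜 for a k-uniform family ℬ: every (k-1)-element subset of a member of ℬ is in 𝒜.
-- (the (k-1)-element condition is written as  suc ∣ S ∣ ≡ k, valid since k ≥ 1)
ShadowSubset : ∀ {n} → ℕ → Family n → Family n → Set
ShadowSubset k ℬ 𝒜 = ∀ {B S} → B ∈F ℬ → S ⊆ B → suc ∣ S ∣ ≡ k → S ∈F 𝒜

-- Two members of ℬ share at least two points: otherwise some (k−1)-subset of one of them misses
-- the other, although it lies in ∂ℬ ⊆ 𝒜.  Let 𝒩 be the family of (k−1)-sets missing some member
-- of ℬ.  Cross-intersection makes 𝒜 and 𝒩 disjoint, so |𝒜| ≤ C(n,k−1) − |𝒩|, and it remains to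
-- show |𝒩| ≥ |ℬ| + C(n−k,k−1) − 1.  This goes by induction on n, splitting ℬ according to whether
-- its members contain a fixed point, and uses the bound |f| ≤ |𝒩_c(f)| (𝒩_c(f) = avoiders c f,
-- the c-sets missing some member of f) for b-uniform families f on m points whose members pairwise
-- share at least b − c points, where b + c ≤ m.  That bound follows by double counting when b ≤ c,
-- and otherwise by shifting f towards a fixed point and inducting on m.

{-# OPTIONS --safe #-}
module Submission where

open import Defs
open import Data.Bool using (Bool; true; false; _∧_; _∨_; not; if_then_else_)
open import Data.Bool.Properties using (∧-identityʳ; ∧-zeroʳ; ∨-identityʳ; ∨-zeroʳ; not-involutive; T-≡)
open import Data.Empty using (⊥-elim)
open import Data.Fin using (Fin; zero; suc)
open import Data.Fin.Subset using (Subset; ∣_∣; _∩_; _⊆_; ⊥; Nonempty)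
open import Data.Fin.Subset.Properties
  using (∣p∣≤n; ∣⊥∣≡0; ∩-comm; ∩-idem; ∣p∩q∣≤∣p∣; ∣p∩q∣≤∣q∣; ⊆-refl; out⊆; s⊆s; x∈p⇒∣p-x∣<∣p∣)
open import Data.List using (List; []; _∷_; length; foldr; allFin)
import Data.List.Membership.DecPropositional as DecMembership
open import Data.List.Membership.Propositional using () renaming (_∈_ to _∈ₗ_)
open import Data.List.Membership.Propositional.Properties using (∈-allFin)
open import Data.List.Relation.Unary.All as All using ()
open import Data.List.Relation.Unary.AllPairs using ([]; _∷_)
open import Data.List.Relation.Unary.Any using (here; there)
open import Data.List.Relation.Unary.Unique.Propositional using (Unique)
open import Data.Nat using (ℕ; zero; suc; _+_; _*_; _∸_; _≤_; _<_; _≤?_; _≡ᵇ_; z≤n; s≤s; >-nonZero)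
open import Data.Nat.Combinatorics using (_C_; nCk≡nC[n∸k]; nCn≡1; nCk+nC[k+1]≡[n+1]C[k+1])
open import Data.Nat.Properties
open import Algebra.Properties.CommutativeSemigroup +-commutativeSemigroup using (interchange; x∙yz≈y∙xz)
open import Algebra.Properties.Semigroup +-semigroup using (uv≈wx⇒yu∙vz≈yw∙xz; uv∙wx≈u[vw∙x])
open import Data.Product using (∃; ∃₂; _×_; _,_; proj₁; proj₂)
open import Data.Sum using (_⊎_; inj₁; inj₂)
open import Data.Vec using ([]; _∷_; tail; lookup; updateAt)
open import Data.Vec.Properties using (≡-dec; lookup∘updateAt; updateAt-updateAt-local; updateAt-id)
open import Function.Bundles using (Equivalence)
open import Relation.Binary.PropositionalEquality
open import Relation.Nullary using (¬_; Dec; does; yes; no; contradiction)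
open import Relation.Nullary.Decidable using (dec-true; dec-false)

∧-true⁻ : ∀ a b → a ∧ b ≡ true → a ≡ true × b ≡ true
∧-true⁻ true true _ = refl , refl

≡ᵇ-sound : ∀ {m n} → (m ≡ᵇ n) ≡ true → m ≡ n
≡ᵇ-sound {m} {n} m≡ᵇn = ≡ᵇ⇒≡ m n (Equivalence.from T-≡ m≡ᵇn)

≡ᵇ-complete : ∀ {m n} → m ≡ n → (m ≡ᵇ n) ≡ true
≡ᵇ-complete {m} {n} m≡n = Equivalence.to T-≡ (≡⇒≡ᵇ m n m≡n)

_≟ₛ_ : ∀ {m} (S T : Subset m) → Dec (S ≡ T)
_≟ₛ_ = ≡-dec Data.Bool._≟_

indicator : Bool → ℕ
indicator true  = 1
indicator false = 0

indicator-mono : ∀ a b → (a ≡ true → b ≡ true) → indicator a ≤ indicator b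
indicator-mono true  b a⇒b rewrite a⇒b refl = ≤-refl
indicator-mono false b a⇒b = z≤n

indicator-+-mono : ∀ a₁ a₂ b₁ b₂ →
  (a₁ ≡ true → b₁ ≡ true × b₂ ≡ true) → (a₂ ≡ true → b₁ ≡ true ⊎ b₂ ≡ true) →
  indicator a₁ + indicator a₂ ≤ indicator b₁ + indicator b₂
indicator-+-mono true  a₂    b₁ b₂ both one with both refl
... | refl , refl = s≤s (indicator-mono a₂ true (λ _ → refl))
indicator-+-mono false true  b₁ b₂ both one with one refl
... | inj₁ refl = s≤s z≤n
... | inj₂ refl = m≤n+m 1 (indicator b₁)
indicator-+-mono false false b₁ b₂ both one = z≤n

-- A family of subsets of Fin m is a Boolean predicate on Subset m; it is counted by summing
-- its indicator over all 2^m subsets.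
sumSubsets : ∀ {m} → (Subset m → ℕ) → ℕ
sumSubsets {zero}  g = g []
sumSubsets {suc m} g = sumSubsets (λ T → g (false ∷ T)) + sumSubsets (λ T → g (true ∷ T))

count : ∀ {m} → (Subset m → Bool) → ℕ
count f = sumSubsets (λ S → indicator (f S))

sumSubsets-cong : ∀ {m} (g h : Subset m → ℕ) → (∀ S → g S ≡ h S) → sumSubsets g ≡ sumSubsets h
sumSubsets-cong {zero}  g h e = e []
sumSubsets-cong {suc m} g h e =
  cong₂ _+_ (sumSubsets-cong {m} _ _ (λ T → e (false ∷ T)))
            (sumSubsets-cong {m} _ _ (λ T → e (true ∷ T)))

sumSubsets-mono-≤ : ∀ {m} (g h : Subset m → ℕ) → (∀ S → g S ≤ h S) → sumSubsets g ≤ sumSubsets h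
sumSubsets-mono-≤ {zero}  g h e = e []
sumSubsets-mono-≤ {suc m} g h e =
  +-mono-≤ (sumSubsets-mono-≤ {m} _ _ (λ T → e (false ∷ T)))
           (sumSubsets-mono-≤ {m} _ _ (λ T → e (true ∷ T)))

sumSubsets-zero : ∀ {m} (g : Subset m → ℕ) → (∀ S → g S ≡ 0) → sumSubsets g ≡ 0
sumSubsets-zero {zero}  g e = e []
sumSubsets-zero {suc m} g e =
  cong₂ _+_ (sumSubsets-zero {m} _ (λ T → e (false ∷ T))) (sumSubsets-zero {m} _ (λ T → e (true ∷ T)))

sumSubsets-distrib-+ : ∀ {m} (g h : Subset m → ℕ) →
  sumSubsets (λ S → g S + h S) ≡ sumSubsets g + sumSubsets h
sumSubsets-distrib-+ {zero}  g h = refl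
sumSubsets-distrib-+ {suc m} g h =
  trans (cong₂ _+_ (sumSubsets-distrib-+ {m} _ _) (sumSubsets-distrib-+ {m} _ _))
        (interchange (sumSubsets (λ T → g (false ∷ T))) _ _ _)

sumSubsets-*ˡ : ∀ {m} k (g : Subset m → ℕ) → sumSubsets (λ S → k * g S) ≡ k * sumSubsets g
sumSubsets-*ˡ {zero}  k g = refl
sumSubsets-*ˡ {suc m} k g =
  trans (cong₂ _+_ (sumSubsets-*ˡ {m} k _) (sumSubsets-*ˡ {m} k _))
        (sym (*-distribˡ-+ k (sumSubsets (λ T → g (false ∷ T))) _))

sumSubsets-swap : ∀ {m k} (h : Subset m → Subset k → ℕ) →
  sumSubsets (λ B → sumSubsets (h B)) ≡ sumSubsets (λ S → sumSubsets (λ B → h B S))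
sumSubsets-swap {zero}      h = refl
sumSubsets-swap {suc m} {k} h =
  trans (cong₂ _+_ (sumSubsets-swap {m} {k} (λ B → h (false ∷ B))) (sumSubsets-swap {m} {k} (λ B → h (true ∷ B))))
        (sym (sumSubsets-distrib-+ {k} (λ S → sumSubsets (λ B → h (false ∷ B) S))
                                       (λ S → sumSubsets (λ B → h (true ∷ B) S))))

count-cong : ∀ {m} (f g : Subset m → Bool) → (∀ S → f S ≡ g S) → count f ≡ count g
count-cong f g e = sumSubsets-cong _ _ (λ S → cong indicator (e S))

count-mono : ∀ {m} (f g : Subset m → Bool) → (∀ S → f S ≡ true → g S ≡ true) → count f ≤ count g
count-mono f g f⇒g = sumSubsets-mono-≤ _ _ (λ S → indicator-mono (f S) (g S) (f⇒g S))

count-none : ∀ {m} (f : Subset m → Bool) → (∀ S → f S ≡ false) → count f ≡ 0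
count-none f e = sumSubsets-zero _ (λ S → cong indicator (e S))

count-singleton : ∀ {m} (S : Subset m) → count (λ T → does (T ≟ₛ S)) ≡ 1
count-singleton []          = refl
count-singleton {suc m} (true ∷ S)  = cong₂ _+_ (count-none {m} _ (λ _ → refl)) (count-singleton S)
count-singleton {suc m} (false ∷ S) = cong₂ _+_ (count-singleton S) (count-none {m} _ (λ _ → refl))

anySubset : ∀ {m} → (Subset m → Bool) → Bool
anySubset {zero}  f = f []
anySubset {suc m} f = anySubset (λ T → f (false ∷ T)) ∨ anySubset (λ T → f (true ∷ T))

anySubset⁺ : ∀ {m} (f : Subset m → Bool) B → f B ≡ true → anySubset f ≡ true
anySubset⁺ {zero}  f []          fB = fB
anySubset⁺ {suc m} f (false ∷ B) fB rewrite anySubset⁺ (λ T → f (false ∷ T)) B fB = refl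
anySubset⁺ {suc m} f (true ∷ B)  fB rewrite anySubset⁺ (λ T → f (true ∷ T)) B fB = ∨-zeroʳ _

anySubset⁻ : ∀ {m} (f : Subset m → Bool) → anySubset f ≡ true → ∃ λ B → f B ≡ true
anySubset⁻ {zero}  f any-f = [] , any-f
anySubset⁻ {suc m} f any-f with anySubset (λ T → f (false ∷ T)) in any-f₀
... | true  = let B , fB = anySubset⁻ (λ T → f (false ∷ T)) any-f₀ in false ∷ B , fB
... | false = let B , fB = anySubset⁻ (λ T → f (true ∷ T)) any-f in true ∷ B , fB

¬anySubset⇒count≡0 : ∀ {m} (f : Subset m → Bool) → anySubset f ≡ false → count f ≡ 0
¬anySubset⇒count≡0 f ¬any-f = count-none f no-member
  where
  no-member : ∀ S → f S ≡ false
  no-member S with f S in fS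
  ... | false = refl
  ... | true  = trans (sym (anySubset⁺ f S fS)) ¬any-f

count-positive : ∀ {m} (f : Subset m → Bool) S → f S ≡ true → 1 ≤ count f
count-positive f S fS = subst (_≤ count f) (count-singleton S) (count-mono _ f only-S)
  where
  only-S : ∀ T → does (T ≟ₛ S) ≡ true → f T ≡ true
  only-S T T≡S with T ≟ₛ S
  ... | yes refl = fS

count≤1 : ∀ {m} (f : Subset m → Bool) → (∀ S S′ → f S ≡ true → f S′ ≡ true → S ≡ S′) → count f ≤ 1
count≤1 f unique with anySubset f in any-f
... | false = ≤-trans (≤-reflexive (¬anySubset⇒count≡0 f any-f)) z≤n
... | true  = subst (count f ≤_) (count-singleton S₀) (count-mono f _ is-S₀)
  where
  S₀ = proj₁ (anySubset⁻ f any-f)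
  is-S₀ : ∀ S → f S ≡ true → does (S ≟ₛ S₀) ≡ true
  is-S₀ S fS = dec-true (S ≟ₛ S₀) (unique S S₀ fS (proj₂ (anySubset⁻ f any-f)))

count-remove : ∀ {m} (f : Subset m → Bool) S → f S ≡ true →
  count f ≡ suc (count (λ T → f T ∧ not (does (T ≟ₛ S))))
count-remove {m} f S fS = begin
  count f                                                          ≡⟨ sumSubsets-cong {m} _ _ split ⟩
  sumSubsets (λ T → indicator (is-S T) + indicator (f∖S T))        ≡⟨ sumSubsets-distrib-+ {m} _ _ ⟩
  count is-S + count f∖S                                           ≡⟨ cong (_+ count f∖S) (count-singleton S) ⟩
  suc (count f∖S)                                                  ∎
  where
  open ≡-Reasoning
  is-S f∖S : Subset m → Bool
  is-S T = does (T ≟ₛ S)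
  f∖S  T = f T ∧ not (is-S T)
  split : ∀ T → indicator (f T) ≡ indicator (is-S T) + indicator (f∖S T)
  split T with T ≟ₛ S
  ... | yes refl rewrite fS = refl
  ... | no  _    rewrite ∧-identityʳ (f T) = refl

length≤count : ∀ {m} (f : Subset m → Bool) (xs : List (Subset m)) →
  Unique xs → (∀ {S} → S ∈ₗ xs → f S ≡ true) → length xs ≤ count f
length≤count f []       _          _      = z≤n
length≤count f (x ∷ xs) (x∉xs ∷ u) all-f  = begin
  suc (length xs)                                       ≤⟨ s≤s (length≤count _ xs u f∧≢x) ⟩
  suc (count (λ T → f T ∧ not (does (T ≟ₛ x))))       ≡⟨ count-remove f x (all-f (here refl)) ⟨
  count f                                               ∎
  where
  open ≤-Reasoning
  f∧≢x : ∀ {S} → S ∈ₗ xs → f S ∧ not (does (S ≟ₛ x)) ≡ true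
  f∧≢x {S} S∈xs rewrite all-f (there S∈xs)
                      | dec-false (S ≟ₛ x) (λ S≡x → All.lookup x∉xs S∈xs (sym S≡x)) = refl

count+count≤count : ∀ {m} (f g h : Subset m → Bool) → (∀ S → f S ≡ true → ¬ g S ≡ true) →
  (∀ S → f S ≡ true → h S ≡ true) → (∀ S → g S ≡ true → h S ≡ true) → count f + count g ≤ count h
count+count≤count {m} f g h disjoint f⊆h g⊆h =
  ≤-trans (≤-reflexive (sym (sumSubsets-distrib-+ {m} _ _))) (sumSubsets-mono-≤ {m} _ _ pointwise)
  where
  pointwise : ∀ S → indicator (f S) + indicator (g S) ≤ indicator (h S)
  pointwise S with f S in fS | g S in gS
  ... | true  | true  = ⊥-elim (disjoint S fS gS)
  ... | true  | false = ≤-trans (≤-reflexive (+-identityʳ 1)) (indicator-mono true (h S) (λ _ → f⊆h S fS))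
  ... | false | true  = indicator-mono true (h S) (λ _ → g⊆h S gS)
  ... | false | false = z≤n

double-counting : ∀ {m} (f g : Subset m → Bool) (R : Subset m → Subset m → Bool) {K K′} →
  (∀ B → f B ≡ true → K ≤ count (R B)) →
  (∀ S → g S ≡ true → count (λ B → f B ∧ R B S) ≤ K′) →
  (∀ B S → f B ≡ true → R B S ≡ true → g S ≡ true) →
  K * count f ≤ K′ * count g
double-counting {m} f g R {K} {K′} many few related = begin
  K * count f                                                    ≡⟨ sumSubsets-*ˡ {m} K _ ⟨
  sumSubsets (λ B → K * indicator (f B))                         ≤⟨ sumSubsets-mono-≤ {m} _ _ row ⟩
  sumSubsets (λ B → sumSubsets (λ S → indicator (f B ∧ R B S)))  ≡⟨ sumSubsets-swap (λ B S → indicator (f B ∧ R B S)) ⟩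
  sumSubsets (λ S → sumSubsets (λ B → indicator (f B ∧ R B S)))  ≤⟨ sumSubsets-mono-≤ {m} _ _ column ⟩
  sumSubsets (λ S → K′ * indicator (g S))                        ≡⟨ sumSubsets-*ˡ {m} K′ _ ⟩
  K′ * count g                                                   ∎
  where
  open ≤-Reasoning
  row : ∀ B → K * indicator (f B) ≤ sumSubsets (λ S → indicator (f B ∧ R B S))
  row B with f B in fB
  ... | true  = ≤-trans (≤-reflexive (*-identityʳ K)) (many B fB)
  ... | false = ≤-trans (≤-reflexive (*-zeroʳ K)) z≤n
  column : ∀ S → sumSubsets (λ B → indicator (f B ∧ R B S)) ≤ K′ * indicator (g S)
  column S with g S in gS
  ... | true  = ≤-trans (few S gS) (≤-reflexive (sym (*-identityʳ K′)))
  ... | false = ≤-trans (≤-reflexive (count-none _ unrelated)) z≤n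
    where
    unrelated : ∀ B → f B ∧ R B S ≡ false
    unrelated B with f B in fB | R B S in RBS
    ... | true  | true  = contradiction (trans (sym (related B S fB RBS)) gS) λ ()
    ... | true  | false = refl
    ... | false | _     = refl

∣p∣≡0⇒p≡⊥ : ∀ {m} (U : Subset m) → ∣ U ∣ ≡ 0 → U ≡ ⊥
∣p∣≡0⇒p≡⊥ []          _      = refl
∣p∣≡0⇒p≡⊥ (false ∷ U) ∣U∣≡0 = cong (false ∷_) (∣p∣≡0⇒p≡⊥ U ∣U∣≡0)

∣∩∣-maximal⇒≡ : ∀ {m} (U V : Subset m) → ∣ U ∣ ≤ ∣ U ∩ V ∣ → ∣ V ∣ ≤ ∣ U ∩ V ∣ → U ≡ V
∣∩∣-maximal⇒≡ []          []          _          _          = refl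
∣∩∣-maximal⇒≡ (true ∷ U)  (true ∷ V)  (s≤s U≤)   (s≤s V≤)   = cong (true ∷_) (∣∩∣-maximal⇒≡ U V U≤ V≤)
∣∩∣-maximal⇒≡ (false ∷ U) (false ∷ V) U≤         V≤         = cong (false ∷_) (∣∩∣-maximal⇒≡ U V U≤ V≤)
∣∩∣-maximal⇒≡ (true ∷ U)  (false ∷ V) U≤         _          = contradiction U≤ (<⇒≱ (s≤s (∣p∩q∣≤∣p∣ U V)))
∣∩∣-maximal⇒≡ (false ∷ U) (true ∷ V)  _          V≤         = contradiction V≤ (<⇒≱ (s≤s (∣p∩q∣≤∣q∣ U V)))

nonempty⇒∣p∣>0 : ∀ {m} {p : Subset m} → Nonempty p → 0 < ∣ p ∣
nonempty⇒∣p∣>0 (x , x∈p) = ≤-<-trans z≤n (x∈p⇒∣p-x∣<∣p∣ x∈p)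

common-element : ∀ {m} (U V : Subset m) → 0 < ∣ U ∩ V ∣ → ∃ λ x → lookup U x ≡ true × lookup V x ≡ true
common-element []          []          ()
common-element (true ∷ U)  (true ∷ V)  _       = zero , refl , refl
common-element (true ∷ U)  (false ∷ V) 0<∣U∩V∣ = let x , x∈U∩V = common-element U V 0<∣U∩V∣ in suc x , x∈U∩V
common-element (false ∷ U) (v ∷ V)     0<∣U∩V∣ = let x , x∈U∩V = common-element U V 0<∣U∩V∣ in suc x , x∈U∩V

m∸n≡[m∸[o+n]]+o : ∀ m n o → o + n ≤ m → m ∸ n ≡ (m ∸ (o + n)) + o
m∸n≡[m∸[o+n]]+o m n o o+n≤m = begin
  m ∸ n                         ≡⟨ cong (_∸ n) (m∸n+n≡m o+n≤m) ⟨
  (m ∸ (o + n)) + (o + n) ∸ n   ≡⟨ cong (_∸ n) (+-assoc (m ∸ (o + n)) o n) ⟨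
  (m ∸ (o + n)) + o + n ∸ n     ≡⟨ m+n∸n≡m _ n ⟩
  (m ∸ (o + n)) + o             ∎
  where open ≡-Reasoning

-- Binomial coefficients

nCk≤[1+n]Ck : ∀ n k → n C k ≤ suc n C k
nCk≤[1+n]Ck n zero    = ≤-refl
nCk≤[1+n]Ck n (suc k) = ≤-trans (m≤n+m (n C suc k) (n C k)) (≤-reflexive (nCk+nC[k+1]≡[n+1]C[k+1] n k))

nCk≤[d+n]Ck : ∀ d n k → n C k ≤ (d + n) C k
nCk≤[d+n]Ck zero    n k = ≤-refl
nCk≤[d+n]Ck (suc d) n k = ≤-trans (nCk≤[d+n]Ck d n k) (nCk≤[1+n]Ck (d + n) k)

k≤n⇒nCk>0 : ∀ {n k} → k ≤ n → 0 < n C k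
k≤n⇒nCk>0 {n}     {zero}  _         = ≤-refl
k≤n⇒nCk>0 {suc n} {suc k} (s≤s k≤n) =
  ≤-trans (k≤n⇒nCk>0 k≤n) (≤-trans (m≤m+n (n C k) _) (≤-reflexive (nCk+nC[k+1]≡[n+1]C[k+1] n k)))

[n∸k]Cj≤nCj : ∀ {n k j} → k ≤ n → (n ∸ k) C j ≤ n C j
[n∸k]Cj≤nCj {n} {k} {j} k≤n =
  subst (λ z → (n ∸ k) C j ≤ z C j) (m+[n∸m]≡n k≤n) (nCk≤[d+n]Ck k (n ∸ k) j)

[p+b]Cb≤[p+c]Cc : ∀ p {b c} → b ≤ c → (p + b) C b ≤ (p + c) C c
[p+b]Cb≤[p+c]Cc p {b} {c} b≤c = begin
  (p + b) C b               ≡⟨ [p+q]Cq≡[p+q]Cp p b ⟩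
  (p + b) C p               ≤⟨ nCk≤[d+n]Ck (c ∸ b) (p + b) p ⟩
  ((c ∸ b) + (p + b)) C p   ≡⟨ cong (_C p) (trans (+-comm (c ∸ b) (p + b))
                                (trans (+-assoc p b _) (cong (p +_) (m+[n∸m]≡n b≤c)))) ⟩
  (p + c) C p               ≡⟨ [p+q]Cq≡[p+q]Cp p c ⟨
  (p + c) C c               ∎
  where
  open ≤-Reasoning
  [p+q]Cq≡[p+q]Cp : ∀ p q → (p + q) C q ≡ (p + q) C p
  [p+q]Cq≡[p+q]Cp p q = trans (nCk≡nC[n∸k] (m≤n+m q p)) (cong ((p + q) C_) (m+n∸n≡m p q))

-- Avoiders

IsUniform : ∀ {m} → ℕ → (Subset m → Bool) → Set
IsUniform b f = ∀ B → f B ≡ true → ∣ B ∣ ≡ b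

-- Any two members share at least b − c points; stated without truncated subtraction.
Intersecting : ∀ {m} → ℕ → ℕ → (Subset m → Bool) → Set
Intersecting b c f = ∀ B B′ → f B ≡ true → f B′ ≡ true → b ≤ ∣ B ∩ B′ ∣ + c

avoids? : ∀ {m} → Subset m → Subset m → Bool
avoids? S B = ∣ S ∩ B ∣ ≡ᵇ 0

avoids?-sym : ∀ {m} (S B : Subset m) → avoids? S B ≡ avoids? B S
avoids?-sym S B = cong (λ X → ∣ X ∣ ≡ᵇ 0) (∩-comm S B)

avoids?-⊥ : ∀ {m} (S : Subset m) → avoids? S ⊥ ≡ true
avoids?-⊥ []          = refl
avoids?-⊥ (true ∷ S)  = avoids?-⊥ S
avoids?-⊥ (false ∷ S) = avoids?-⊥ S

count-avoiding : ∀ {m} c (B : Subset m) → count (λ S → (∣ S ∣ ≡ᵇ c) ∧ avoids? S B) ≡ (m ∸ ∣ B ∣) C c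
count-avoiding {zero}  zero    []          = refl
count-avoiding {zero}  (suc c) []          = refl
count-avoiding {suc m} c       (true ∷ B)  =
  trans (cong₂ _+_ (count-avoiding c B) (count-none {m} _ (λ T → ∧-zeroʳ _))) (+-identityʳ _)
count-avoiding {suc m} zero    (false ∷ B) =
  cong₂ _+_ (count-avoiding zero B) (count-none {m} _ (λ T → refl))
count-avoiding {suc m} (suc c) (false ∷ B) = begin
  count (λ S → (∣ S ∣ ≡ᵇ suc c) ∧ avoids? S (false ∷ B))
                                          ≡⟨ cong₂ _+_ (count-avoiding (suc c) B) (count-avoiding c B) ⟩
  (m ∸ ∣ B ∣) C suc c + (m ∸ ∣ B ∣) C c   ≡⟨ +-comm _ ((m ∸ ∣ B ∣) C c) ⟩
  (m ∸ ∣ B ∣) C c + (m ∸ ∣ B ∣) C suc c   ≡⟨ nCk+nC[k+1]≡[n+1]C[k+1] (m ∸ ∣ B ∣) c ⟩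
  suc (m ∸ ∣ B ∣) C suc c                 ≡⟨ cong (_C suc c) (+-∸-assoc 1 (∣p∣≤n B)) ⟨
  (suc m ∸ ∣ B ∣) C suc c                 ∎
  where open ≡-Reasoning

count-sized : ∀ {m} c → count (λ (S : Subset m) → ∣ S ∣ ≡ᵇ c) ≡ m C c
count-sized {m} c = begin
  count {m} (λ S → ∣ S ∣ ≡ᵇ c)                 ≡⟨ count-cong {m} _ _ avoiding-⊥ ⟩
  count {m} (λ S → (∣ S ∣ ≡ᵇ c) ∧ avoids? S ⊥) ≡⟨ count-avoiding {m} c ⊥ ⟩
  (m ∸ ∣ ⊥ {m} ∣) C c                          ≡⟨ cong (λ z → (m ∸ z) C c) (∣⊥∣≡0 m) ⟩
  m C c                                        ∎
  where
  open ≡-Reasoning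
  avoiding-⊥ : ∀ S → (∣ S ∣ ≡ᵇ c) ≡ (∣ S ∣ ≡ᵇ c) ∧ avoids? S ⊥
  avoiding-⊥ S rewrite avoids?-⊥ S = sym (∧-identityʳ _)

avoiders : ∀ {m} → ℕ → (Subset m → Bool) → Subset m → Bool
avoiders c f S = (∣ S ∣ ≡ᵇ c) ∧ anySubset (λ B → f B ∧ avoids? S B)

avoiders⁺ : ∀ {m} c (f : Subset m → Bool) S B → f B ≡ true → avoids? S B ≡ true → ∣ S ∣ ≡ c →
  avoiders c f S ≡ true
avoiders⁺ c f S B fB S∩B≡∅ ∣S∣≡c rewrite ≡ᵇ-complete ∣S∣≡c =
  anySubset⁺ (λ B → f B ∧ avoids? S B) B (cong₂ _∧_ fB S∩B≡∅)

avoiders⁻ : ∀ {m} c (f : Subset m → Bool) S → avoiders c f S ≡ true →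
  ∣ S ∣ ≡ c × ∃ λ B → f B ≡ true × avoids? S B ≡ true
avoiders⁻ c f S S∈ =
  let ∣S∣≡ᵇc , some-B = ∧-true⁻ (∣ S ∣ ≡ᵇ c) _ S∈
      B , fB∧S∩B≡∅ = anySubset⁻ (λ B → f B ∧ avoids? S B) some-B
  in ≡ᵇ-sound ∣S∣≡ᵇc , B , ∧-true⁻ (f B) _ fB∧S∩B≡∅

count-avoiding≤count-avoiders : ∀ {m} c (f : Subset m → Bool) B → f B ≡ true →
  (m ∸ ∣ B ∣) C c ≤ count (avoiders c f)
count-avoiding≤count-avoiders c f B fB =
  subst (_≤ count (avoiders c f)) (count-avoiding c B) (count-mono _ _ avoiding⇒avoider)
  where
  avoiding⇒avoider : ∀ S → (∣ S ∣ ≡ᵇ c) ∧ avoids? S B ≡ true → avoiders c f S ≡ true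
  avoiding⇒avoider S S∈ =
    let ∣S∣≡ᵇc , S∩B≡∅ = ∧-true⁻ _ _ S∈ in avoiders⁺ c f S B fB S∩B≡∅ (≡ᵇ-sound ∣S∣≡ᵇc)

-- Shifting

toggle : ∀ {m} → Fin m → Subset m → Subset m
toggle x U = updateAt U x not

toggle-involutive : ∀ {m} (x : Fin m) U → toggle x (toggle x U) ≡ U
toggle-involutive x U = trans (updateAt-updateAt-local x U (not-involutive (lookup U x))) (updateAt-id x U)

∣toggle∣-∉ : ∀ {m} (x : Fin m) U → lookup U x ≡ false → ∣ toggle x U ∣ ≡ suc ∣ U ∣
∣toggle∣-∉ zero    (false ∷ U) _   = refl
∣toggle∣-∉ (suc x) (true ∷ U)  x∉U = cong suc (∣toggle∣-∉ x U x∉U)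
∣toggle∣-∉ (suc x) (false ∷ U) x∉U = ∣toggle∣-∉ x U x∉U

∣toggle∣-∈ : ∀ {m} (x : Fin m) U → lookup U x ≡ true → suc ∣ toggle x U ∣ ≡ ∣ U ∣
∣toggle∣-∈ zero    (true ∷ U)  _   = refl
∣toggle∣-∈ (suc x) (true ∷ U)  x∈U = cong suc (∣toggle∣-∈ x U x∈U)
∣toggle∣-∈ (suc x) (false ∷ U) x∈U = ∣toggle∣-∈ x U x∈U

∣toggle∩∣≤1+∣∩∣ : ∀ {m} (x : Fin m) U V → lookup U x ≡ false → ∣ toggle x U ∩ V ∣ ≤ suc ∣ U ∩ V ∣
∣toggle∩∣≤1+∣∩∣ zero    (false ∷ U) (true ∷ V)  _   = ≤-refl
∣toggle∩∣≤1+∣∩∣ zero    (false ∷ U) (false ∷ V) _   = n≤1+n _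
∣toggle∩∣≤1+∣∩∣ (suc x) (true ∷ U)  (true ∷ V)  x∉U = s≤s (∣toggle∩∣≤1+∣∩∣ x U V x∉U)
∣toggle∩∣≤1+∣∩∣ (suc x) (true ∷ U)  (false ∷ V) x∉U = ∣toggle∩∣≤1+∣∩∣ x U V x∉U
∣toggle∩∣≤1+∣∩∣ (suc x) (false ∷ U) (v ∷ V)     x∉U = ∣toggle∩∣≤1+∣∩∣ x U V x∉U

∣toggle∩∣≡∣∩∣ : ∀ {m} (x : Fin m) U V → lookup V x ≡ false → ∣ toggle x U ∩ V ∣ ≡ ∣ U ∩ V ∣
∣toggle∩∣≡∣∩∣ zero    (true ∷ U)  (false ∷ V) _   = refl
∣toggle∩∣≡∣∩∣ zero    (false ∷ U) (false ∷ V) _   = refl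
∣toggle∩∣≡∣∩∣ (suc x) (true ∷ U)  (true ∷ V)  x∉V = cong suc (∣toggle∩∣≡∣∩∣ x U V x∉V)
∣toggle∩∣≡∣∩∣ (suc x) (true ∷ U)  (false ∷ V) x∉V = ∣toggle∩∣≡∣∩∣ x U V x∉V
∣toggle∩∣≡∣∩∣ (suc x) (false ∷ U) (v ∷ V)     x∉V = ∣toggle∩∣≡∣∩∣ x U V x∉V

1+∣toggle∩∣≡∣∩∣ : ∀ {m} (x : Fin m) U V → lookup U x ≡ true → lookup V x ≡ true →
  suc ∣ toggle x U ∩ V ∣ ≡ ∣ U ∩ V ∣
1+∣toggle∩∣≡∣∩∣ zero    (true ∷ U)  (true ∷ V)  _   _   = refl
1+∣toggle∩∣≡∣∩∣ (suc x) (true ∷ U)  (true ∷ V)  x∈U x∈V = cong suc (1+∣toggle∩∣≡∣∩∣ x U V x∈U x∈V)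
1+∣toggle∩∣≡∣∩∣ (suc x) (true ∷ U)  (false ∷ V) x∈U x∈V = 1+∣toggle∩∣≡∣∩∣ x U V x∈U x∈V
1+∣toggle∩∣≡∣∩∣ (suc x) (false ∷ U) (v ∷ V)     x∈U x∈V = 1+∣toggle∩∣≡∣∩∣ x U V x∈U x∈V

∣toggle∩toggle∣≡∣∩∣ : ∀ {m} (x : Fin m) U V → lookup U x ≡ false → lookup V x ≡ true →
  ∣ toggle x U ∩ toggle x V ∣ ≡ ∣ U ∩ V ∣
∣toggle∩toggle∣≡∣∩∣ zero    (false ∷ U) (true ∷ V)  _   _   = refl
∣toggle∩toggle∣≡∣∩∣ (suc x) (true ∷ U)  (true ∷ V)  x∉U x∈V = cong suc (∣toggle∩toggle∣≡∣∩∣ x U V x∉U x∈V)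
∣toggle∩toggle∣≡∣∩∣ (suc x) (true ∷ U)  (false ∷ V) x∉U x∈V = ∣toggle∩toggle∣≡∣∩∣ x U V x∉U x∈V
∣toggle∩toggle∣≡∣∩∣ (suc x) (false ∷ U) (v ∷ V)     x∉U x∈V = ∣toggle∩toggle∣≡∣∩∣ x U V x∉U x∈V

∣toggle∩toggle∣≡1+∣∩∣ : ∀ {m} (x : Fin m) U V → lookup U x ≡ false → lookup V x ≡ false →
  ∣ toggle x U ∩ toggle x V ∣ ≡ suc ∣ U ∩ V ∣
∣toggle∩toggle∣≡1+∣∩∣ zero    (false ∷ U) (false ∷ V) _   _   = refl
∣toggle∩toggle∣≡1+∣∩∣ (suc x) (true ∷ U)  (true ∷ V)  x∉U x∉V = cong suc (∣toggle∩toggle∣≡1+∣∩∣ x U V x∉U x∉V)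
∣toggle∩toggle∣≡1+∣∩∣ (suc x) (true ∷ U)  (false ∷ V) x∉U x∉V = ∣toggle∩toggle∣≡1+∣∩∣ x U V x∉U x∉V
∣toggle∩toggle∣≡1+∣∩∣ (suc x) (false ∷ U) (v ∷ V)     x∉U x∉V = ∣toggle∩toggle∣≡1+∣∩∣ x U V x∉U x∉V

avoids?-toggleˡ : ∀ {m} (x : Fin m) U V → lookup V x ≡ false → avoids? (toggle x U) V ≡ avoids? U V
avoids?-toggleˡ x U V x∉V = cong (_≡ᵇ 0) (∣toggle∩∣≡∣∩∣ x U V x∉V)

avoids?-toggleʳ : ∀ {m} (x : Fin m) W U → lookup W x ≡ false → avoids? W (toggle x U) ≡ avoids? W U
avoids?-toggleʳ x W U x∉W = trans (avoids?-sym W _) (trans (avoids?-toggleˡ x U W x∉W) (avoids?-sym U W))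

avoids?-toggle : ∀ {m} (x : Fin m) W V → lookup W x ≡ true → avoids? W V ≡ true →
  avoids? (toggle x W) (toggle x V) ≡ true
avoids?-toggle zero    (true ∷ W)  (false ∷ V) _   W∩V≡∅ = W∩V≡∅
avoids?-toggle (suc x) (true ∷ W)  (false ∷ V) x∈W W∩V≡∅ = avoids?-toggle x W V x∈W W∩V≡∅
avoids?-toggle (suc x) (false ∷ W) (v ∷ V)     x∈W W∩V≡∅ = avoids?-toggle x W V x∈W W∩V≡∅

sumSubsets-toggle : ∀ {m} (x : Fin m) (g : Subset m → ℕ) → sumSubsets (λ T → g (toggle x T)) ≡ sumSubsets g
sumSubsets-toggle zero    g = +-comm (sumSubsets (λ T → g (true ∷ T))) _
sumSubsets-toggle (suc x) g =
  cong₂ _+_ (sumSubsets-toggle x (λ T → g (false ∷ T))) (sumSubsets-toggle x (λ T → g (true ∷ T)))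

sumSubsets-paired : ∀ {m} (x : Fin m) (g : Subset m → ℕ) →
  sumSubsets g ≡ sumSubsets (λ T → if lookup T x then 0 else g T + g (toggle x T))
sumSubsets-paired {m} x g = begin
  sumSubsets g                                               ≡⟨ sumSubsets-cong {m} _ _ split ⟩
  sumSubsets (λ T → g∉ T + g∈ T)                             ≡⟨ sumSubsets-distrib-+ {m} _ _ ⟩
  sumSubsets g∉ + sumSubsets g∈                              ≡⟨ cong (sumSubsets g∉ +_) (sumSubsets-toggle x g∈) ⟨
  sumSubsets g∉ + sumSubsets (λ T → g∈ (toggle x T))         ≡⟨ sumSubsets-distrib-+ {m} _ _ ⟨
  sumSubsets (λ T → g∉ T + g∈ (toggle x T))                  ≡⟨ sumSubsets-cong {m} _ _ merge ⟩
  sumSubsets (λ T → if lookup T x then 0 else g T + g (toggle x T)) ∎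
  where
  open ≡-Reasoning
  g∉ g∈ : Subset m → ℕ
  g∉ T = if lookup T x then 0 else g T
  g∈ T = if lookup T x then g T else 0
  split : ∀ T → g T ≡ g∉ T + g∈ T
  split T with lookup T x
  ... | true  = refl
  ... | false = sym (+-identityʳ (g T))
  merge : ∀ T → g∉ T + g∈ (toggle x T) ≡ (if lookup T x then 0 else g T + g (toggle x T))
  merge T rewrite lookup∘updateAt x {not} T with lookup T x
  ... | true  = refl
  ... | false = refl

sumSubsets-mono-≤-paired : ∀ {m} (x : Fin m) (g h : Subset m → ℕ) →
  (∀ T → lookup T x ≡ false → g T + g (toggle x T) ≤ h T + h (toggle x T)) → sumSubsets g ≤ sumSubsets h
sumSubsets-mono-≤-paired {m} x g h pairs =
  subst₂ _≤_ (sym (sumSubsets-paired x g)) (sym (sumSubsets-paired x h)) (sumSubsets-mono-≤ {m} _ _ pointwise)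
  where
  pointwise : ∀ T → (if lookup T x then 0 else g T + g (toggle x T)) ≤ (if lookup T x then 0 else h T + h (toggle x T))
  pointwise T with lookup T x in T-at-x
  ... | true  = z≤n
  ... | false = pairs T T-at-x

sumSubsets-cong-paired : ∀ {m} (x : Fin m) (g h : Subset m → ℕ) →
  (∀ T → lookup T x ≡ false → g T + g (toggle x T) ≡ h T + h (toggle x T)) → sumSubsets g ≡ sumSubsets h
sumSubsets-cong-paired x g h pairs = ≤-antisym
  (sumSubsets-mono-≤-paired x g h (λ T x∉T → ≤-reflexive (pairs T x∉T)))
  (sumSubsets-mono-≤-paired x h g (λ T x∉T → ≤-reflexive (sym (pairs T x∉T))))

-- The head of a Subset (suc m) is the point 0 and index x of its tail is the point x + 1.
-- shift x f moves every member B ∌ 0 with x + 1 ∈ B to B − (x + 1) + 0, unless that set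
-- is already a member.
shift : ∀ {m} → Fin m → (Subset (suc m) → Bool) → Subset (suc m) → Bool
shift x f (false ∷ T) = f (false ∷ T) ∧ (not (lookup T x) ∨ f (true ∷ toggle x T))
shift x f (true ∷ T)  = f (true ∷ T) ∨ (not (lookup T x) ∧ f (false ∷ toggle x T))

heads : ∀ {m} → (Subset (suc m) → Bool) → Subset m → ℕ
heads F T = indicator (F (false ∷ T)) + indicator (F (true ∷ T))

count-by-heads : ∀ {m} (F : Subset (suc m) → Bool) → count F ≡ sumSubsets (heads F)
count-by-heads {m} F = sym (sumSubsets-distrib-+ {m} _ _)

count-shift : ∀ {m} (x : Fin m) f → count (shift x f) ≡ count f
count-shift x f = begin
  count (shift x f)               ≡⟨ count-by-heads (shift x f) ⟩
  sumSubsets (heads (shift x f))  ≡⟨ sumSubsets-cong-paired x _ _ pairs ⟩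
  sumSubsets (heads f)            ≡⟨ count-by-heads f ⟨
  count f                         ∎
  where
  open ≡-Reasoning
  exchange : ∀ q r → indicator (q ∨ r) + indicator (r ∧ q) ≡ indicator q + indicator r
  exchange true  true  = refl
  exchange true  false = refl
  exchange false r     = trans (cong (λ b → indicator r + indicator b) (∧-zeroʳ r)) (+-identityʳ _)
  pairs : ∀ T → lookup T x ≡ false →
    heads (shift x f) T + heads (shift x f) (toggle x T) ≡ heads f T + heads f (toggle x T)
  pairs T x∉T rewrite lookup∘updateAt x {not} T | x∉T | toggle-involutive x T
                    | ∧-identityʳ (f (false ∷ T)) | ∨-identityʳ (f (true ∷ toggle x T)) =
    uv≈wx⇒yu∙vz≈yw∙xz (exchange (f (true ∷ T)) (f (false ∷ toggle x T)))
                        (indicator (f (false ∷ T))) (indicator (f (true ∷ toggle x T)))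

ShiftedIn : ∀ {m} → Fin m → (Subset (suc m) → Bool) → Subset (suc m) → Set
ShiftedIn x f B = ∃ λ U → B ≡ true ∷ U × lookup U x ≡ false × f (false ∷ toggle x U) ≡ true

shift⁻ : ∀ {m} (x : Fin m) f B → shift x f B ≡ true → f B ≡ true ⊎ ShiftedIn x f B
shift⁻ x f (false ∷ T) B∈ = inj₁ (proj₁ (∧-true⁻ _ _ B∈))
shift⁻ x f (true ∷ T)  B∈ with f (true ∷ T) | lookup T x in T-at-x
... | true  | _     = inj₁ refl
... | false | false = inj₂ (T , refl , T-at-x , B∈)
... | false | true  = contradiction B∈ λ ()

shift-preserves-uniform : ∀ {m b} (x : Fin m) f → IsUniform b f → IsUniform b (shift x f)
shift-preserves-uniform x f uniform B B∈ with shift⁻ x f B B∈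
... | inj₁ fB                   = uniform B fB
... | inj₂ (U , refl , x∉U , fD) = trans (sym (∣toggle∣-∉ x U x∉U)) (uniform _ fD)

Dominated : ∀ {m} → (Subset m → Bool) → Subset m → Subset m → Set
Dominated f B B′ = ∃₂ λ D D′ → f D ≡ true × f D′ ≡ true × ∣ D ∩ D′ ∣ ≤ ∣ B ∩ B′ ∣

shiftedIn-dominated : ∀ {m} (x : Fin m) f B B′ → ShiftedIn x f B → shift x f B′ ≡ true → Dominated f B B′
shiftedIn-dominated x f _ (true ∷ V) (U , refl , x∉U , fD) B′∈ with f (true ∷ V) in fB′ | lookup V x in V-at-x
... | true  | _     = _ , _ , fD , fB′ , ∣toggle∩∣≤1+∣∩∣ x U V x∉U
... | false | false = _ , _ , fD , B′∈ , ≤-reflexive (∣toggle∩toggle∣≡1+∣∩∣ x U V x∉U V-at-x)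
... | false | true  = contradiction B′∈ λ ()
shiftedIn-dominated x f _ (false ∷ V) (U , refl , x∉U , fD) B′∈
  with f (false ∷ V) in fB′ | lookup V x in V-at-x | f (true ∷ toggle x V) in fD′
... | true  | false | _     = _ , _ , fD , fB′ , ≤-reflexive (∣toggle∩∣≡∣∩∣ x U V V-at-x)
... | true  | true  | true  = _ , _ , fD , fD′ , ≤-reflexive (∣toggle∩toggle∣≡∣∩∣ x U V x∉U V-at-x)
... | true  | true  | false = contradiction B′∈ λ ()
... | false | _     | _     = contradiction B′∈ λ ()

shift-dominated : ∀ {m} (x : Fin m) f B B′ → shift x f B ≡ true → shift x f B′ ≡ true → Dominated f B B′
shift-dominated x f B B′ B∈ B′∈ with shift⁻ x f B B∈ | shift⁻ x f B′ B′∈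
... | inj₂ moved | _           = shiftedIn-dominated x f B B′ moved B′∈
... | inj₁ fB    | inj₁ fB′    = B , B′ , fB , fB′ , ≤-refl
... | inj₁ _     | inj₂ moved′ =
  let D′ , D , fD′ , fD , ∣D′∩D∣≤ = shiftedIn-dominated x f B′ B moved′ B∈
  in D , D′ , fD , fD′ , subst₂ _≤_ (cong ∣_∣ (∩-comm D′ D)) (cong ∣_∣ (∩-comm B′ B)) ∣D′∩D∣≤

shift-preserves-intersecting : ∀ {m b c} (x : Fin m) f → Intersecting b c f → Intersecting b c (shift x f)
shift-preserves-intersecting {c = c} x f intersecting B B′ B∈ B′∈ =
  let D , D′ , fD , fD′ , ∣D∩D′∣≤ = shift-dominated x f B B′ B∈ B′∈
  in ≤-trans (intersecting D D′ fD fD′) (+-monoˡ-≤ c ∣D∩D′∣≤)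

Shifted : ∀ {m} → Fin m → (Subset (suc m) → Bool) → Set
Shifted x F = ∀ T → F (false ∷ T) ≡ true → lookup T x ≡ true → F (true ∷ toggle x T) ≡ true

shift-shifted : ∀ {m} (x : Fin m) f → Shifted x (shift x f)
shift-shifted x f T B∈ x∈T with lookup T x | f (false ∷ T) | f (true ∷ toggle x T)
shift-shifted x f T B∈ x∈T | true | true | true = refl

shift-preserves-shifted : ∀ {m} (x y : Fin m) f → Shifted y f → Shifted y (shift x f)
shift-preserves-shifted x y f shifted T B∈ y∈T
  rewrite shifted T (proj₁ (∧-true⁻ (f (false ∷ T)) _ B∈)) y∈T = refl

avoiders-shift-inside⁻ : ∀ {m} c (x : Fin m) f T →
  avoiders c (shift x f) (true ∷ T) ≡ true → avoiders c f (true ∷ T) ≡ true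
avoiders-shift-inside⁻ c x f T S∈ with avoiders⁻ c (shift x f) (true ∷ T) S∈
... | ∣S∣≡c , B , B∈ , S∩B≡∅ with shift⁻ x f B B∈
...   | inj₁ fB                = avoiders⁺ c f (true ∷ T) B fB S∩B≡∅ ∣S∣≡c
...   | inj₂ (U , refl , _ , _) = contradiction S∩B≡∅ λ ()

avoiders-shift-outside⁻ : ∀ {m} c (x : Fin m) f W → avoiders c (shift x f) (false ∷ W) ≡ true →
  avoiders c f (false ∷ W) ≡ true ⊎ lookup W x ≡ true × avoiders c f (true ∷ toggle x W) ≡ true
avoiders-shift-outside⁻ c x f W S∈ with avoiders⁻ c (shift x f) (false ∷ W) S∈
... | ∣S∣≡c , B , B∈ , S∩B≡∅ with shift⁻ x f B B∈
...   | inj₁ fB = inj₁ (avoiders⁺ c f (false ∷ W) B fB S∩B≡∅ ∣S∣≡c)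
...   | inj₂ (U , refl , x∉U , fD) with lookup W x in W-at-x
...     | false = inj₁ (avoiders⁺ c f (false ∷ W) (false ∷ toggle x U) fD
                          (trans (avoids?-toggleʳ x W U W-at-x) S∩B≡∅) ∣S∣≡c)
...     | true  = inj₂ (refl , avoiders⁺ c f (true ∷ toggle x W) (false ∷ toggle x U) fD
                                 (avoids?-toggle x W U W-at-x S∩B≡∅) (trans (∣toggle∣-∈ x W W-at-x) ∣S∣≡c))

avoiders-shift-inside⇒outside : ∀ {m} c (x : Fin m) f T → lookup T x ≡ false →
  avoiders c (shift x f) (true ∷ T) ≡ true → avoiders c f (false ∷ toggle x T) ≡ true
avoiders-shift-inside⇒outside c x f T x∉T S∈ with avoiders⁻ c (shift x f) (true ∷ T) S∈
... | _     , true ∷ V  , _  , ()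
... | ∣S∣≡c , false ∷ V , B∈ , T∩V≡∅
  with f (false ∷ V) in fB | lookup V x in V-at-x | f (true ∷ toggle x V) in fD
...   | true  | false | _     = avoiders⁺ c f (false ∷ toggle x T) (false ∷ V) fB
                                  (trans (avoids?-toggleˡ x T V V-at-x) T∩V≡∅) (trans (∣toggle∣-∉ x T x∉T) ∣S∣≡c)
...   | true  | true  | true  = avoiders⁺ c f (false ∷ toggle x T) (true ∷ toggle x V) fD
                                  (trans (avoids?-sym (toggle x T) (toggle x V))
                                         (avoids?-toggle x V T V-at-x (trans (avoids?-sym V T) T∩V≡∅)))
                                  (trans (∣toggle∣-∉ x T x∉T) ∣S∣≡c)
...   | true  | true  | false = contradiction B∈ λ ()
...   | false | _     | _     = contradiction B∈ λ ()

count-avoiders-shift : ∀ {m} c (x : Fin m) f → count (avoiders c (shift x f)) ≤ count (avoiders c f)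
count-avoiders-shift c x f = begin
  count (avoiders c (shift x f))               ≡⟨ count-by-heads (avoiders c (shift x f)) ⟩
  sumSubsets (heads (avoiders c (shift x f)))  ≤⟨ sumSubsets-mono-≤-paired x _ _ pairs ⟩
  sumSubsets (heads (avoiders c f))            ≡⟨ count-by-heads (avoiders c f) ⟨
  count (avoiders c f)                         ∎
  where
  open ≤-Reasoning
  regroup-≤ : ∀ {a₁ a₂ a₃ a₄ b₁ b₂ b₃ b₄} → a₁ ≤ b₁ → a₂ + a₃ ≤ b₂ + b₃ → a₄ ≤ b₄ →
    (a₁ + a₂) + (a₃ + a₄) ≤ (b₁ + b₂) + (b₃ + b₄)
  regroup-≤ {a₁} {a₂} {a₃} {a₄} {b₁} {b₂} {b₃} {b₄} a₁≤b₁ a₂₃≤b₂₃ a₄≤b₄ =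
    subst₂ _≤_ (sym (uv∙wx≈u[vw∙x] a₁ a₂ a₃ a₄)) (sym (uv∙wx≈u[vw∙x] b₁ b₂ b₃ b₄))
           (+-mono-≤ a₁≤b₁ (+-mono-≤ a₂₃≤b₂₃ a₄≤b₄))
  pairs : ∀ T → lookup T x ≡ false →
    heads (avoiders c (shift x f)) T + heads (avoiders c (shift x f)) (toggle x T)
      ≤ heads (avoiders c f) T + heads (avoiders c f) (toggle x T)
  pairs T x∉T = regroup-≤
    (indicator-mono _ _ outside-stays)
    (indicator-+-mono _ _ _ _ (λ S∈ → avoiders-shift-inside⁻ c x f T S∈ , avoiders-shift-inside⇒outside c x f T x∉T S∈)
                              toggled-outside)
    (indicator-mono _ _ (avoiders-shift-inside⁻ c x f (toggle x T)))
    where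
    outside-stays : avoiders c (shift x f) (false ∷ T) ≡ true → avoiders c f (false ∷ T) ≡ true
    outside-stays S∈ with avoiders-shift-outside⁻ c x f T S∈
    ... | inj₁ S∈f          = S∈f
    ... | inj₂ (x∈T , _)    = contradiction (trans (sym x∈T) x∉T) λ ()
    toggled-outside : avoiders c (shift x f) (false ∷ toggle x T) ≡ true →
      avoiders c f (true ∷ T) ≡ true ⊎ avoiders c f (false ∷ toggle x T) ≡ true
    toggled-outside S∈ with avoiders-shift-outside⁻ c x f (toggle x T) S∈
    ... | inj₁ S∈f       = inj₂ S∈f
    ... | inj₂ (_ , S′∈f) = inj₁ (subst (λ U → avoiders c f (true ∷ U) ≡ true) (toggle-involutive x T) S′∈f)

shiftAll : ∀ {m} → (Subset (suc m) → Bool) → Subset (suc m) → Bool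
shiftAll {m} f = foldr shift f (allFin m)

shiftAll-preserves : ∀ {m} (P : (Subset (suc m) → Bool) → Set) → (∀ x {F} → P F → P (shift x F)) →
  ∀ f → P f → P (shiftAll f)
shiftAll-preserves {m} P preserves f Pf = go (allFin m)
  where
  go : ∀ xs → P (foldr shift f xs)
  go []       = Pf
  go (x ∷ xs) = preserves x (go xs)

shiftAll-shifted : ∀ {m} f (y : Fin m) → Shifted y (shiftAll f)
shiftAll-shifted {m} f y = go (allFin m) (∈-allFin y)
  where
  go : ∀ xs → y ∈ₗ xs → Shifted y (foldr shift f xs)
  go (x ∷ xs) (here refl)  = shift-shifted x (foldr shift f xs)
  go (x ∷ xs) (there y∈xs) = shift-preserves-shifted x y (foldr shift f xs) (go xs y∈xs)

-- Lower bounds for the number of avoiders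

outside₀ inside₀ : ∀ {m} → (Subset (suc m) → Bool) → Subset m → Bool
outside₀ F T = F (false ∷ T)
inside₀  F T = F (true ∷ T)

outside₀-intersecting : ∀ {m b c} (F : Subset (suc m) → Bool) →
  Intersecting (suc b) (suc c) F → Intersecting b c (outside₀ F)
outside₀-intersecting {b = b} {c} F intersecting T T′ T∈ T′∈ =
  ≤-pred (subst (suc b ≤_) (+-suc _ c) (intersecting _ _ T∈ T′∈))

inside₀-intersecting : ∀ {m b c} (F : Subset (suc m) → Bool) →
  Intersecting (suc b) c F → Intersecting b c (inside₀ F)
inside₀-intersecting F intersecting T T′ T∈ T′∈ = ≤-pred (intersecting _ _ T∈ T′∈)

count-avoiders-split : ∀ {m} c (F : Subset (suc m) → Bool) s →
  count (avoiders c (outside₀ F)) + count (avoiders (suc c) (λ T → F (s ∷ T))) ≤ count (avoiders (suc c) F)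
count-avoiders-split c F s = begin
  count (avoiders c (outside₀ F)) + count (avoiders (suc c) (λ T → F (s ∷ T)))
    ≤⟨ +-mono-≤ (count-mono _ _ into-inside) (count-mono _ _ into-outside) ⟩
  count (λ T → avoiders (suc c) F (true ∷ T)) + count (λ T → avoiders (suc c) F (false ∷ T))
    ≡⟨ +-comm (count (λ T → avoiders (suc c) F (true ∷ T))) _ ⟩
  count (avoiders (suc c) F)
    ∎
  where
  open ≤-Reasoning
  into-inside : ∀ T → avoiders c (outside₀ F) T ≡ true → avoiders (suc c) F (true ∷ T) ≡ true
  into-inside T T∈ = let ∣T∣≡c , B , B∈ , T∩B≡∅ = avoiders⁻ c _ T T∈
                     in avoiders⁺ (suc c) F (true ∷ T) (false ∷ B) B∈ T∩B≡∅ (cong suc ∣T∣≡c)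
  into-outside : ∀ T → avoiders (suc c) (λ T → F (s ∷ T)) T ≡ true → avoiders (suc c) F (false ∷ T) ≡ true
  into-outside T T∈ = let ∣T∣≡c , B , B∈ , T∩B≡∅ = avoiders⁻ (suc c) _ T T∈
                      in avoiders⁺ (suc c) F (false ∷ T) (s ∷ B) B∈ T∩B≡∅ ∣T∣≡c

-- If T and T′ share a point, shiftedness moves that point of T to 0; the resulting member of F
-- meets T′ in one point fewer.
shifted-outside₀-intersecting : ∀ {m b c} (F : Subset (suc m) → Bool) → (∀ x → Shifted x F) → c < b →
  Intersecting (suc b) (suc c) F → Intersecting (suc b) c (outside₀ F)
shifted-outside₀-intersecting {b = b} {c} F shifted c<b intersecting T T′ T∈ T′∈ with ∣ T ∩ T′ ∣ in ∣T∩T′∣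
... | zero  = contradiction (subst (λ z → suc b ≤ z + suc c) ∣T∩T′∣ (intersecting _ _ T∈ T′∈)) (<⇒≱ (s≤s c<b))
... | suc k =
  let x , x∈T , x∈T′ = common-element T T′ (subst (0 <_) (sym ∣T∩T′∣) (s≤s z≤n))
      one-fewer = trans (1+∣toggle∩∣≡∣∩∣ x T T′ x∈T x∈T′) ∣T∩T′∣
  in subst (suc b ≤_) (trans (+-suc _ c) (cong (_+ c) one-fewer))
           (intersecting (true ∷ toggle x T) (false ∷ T′) (shifted x T T∈ x∈T) T′∈)

AvoidersBound : ℕ → Set
AvoidersBound m = ∀ {b c} (f : Subset m → Bool) → b + c ≤ m → IsUniform b f → Intersecting b c f →
  count f ≤ count (avoiders c f)

-- Each member of f avoids K c-sets and each c-set avoids at most K′ members of f, where K′ ≤ K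
-- because b ≤ c.
avoidersBound-b≤c : ∀ {m b c} (f : Subset m → Bool) → b ≤ c → b + c ≤ m → IsUniform b f →
  count f ≤ count (avoiders c f)
avoidersBound-b≤c {m} {b} {c} f b≤c b+c≤m uniform = *-cancelˡ-≤ K {{>-nonZero K>0}} (begin
  K * count f                 ≤⟨ double-counting f (avoiders c f) (λ B S → (∣ S ∣ ≡ᵇ c) ∧ avoids? S B)
                                                  many few related ⟩
  K′ * count (avoiders c f)   ≤⟨ *-monoˡ-≤ (count (avoiders c f)) K′≤K ⟩
  K * count (avoiders c f)    ∎)
  where
  open ≤-Reasoning
  p = m ∸ (b + c)
  m∸c≡p+b : m ∸ c ≡ p + b
  m∸c≡p+b = m∸n≡[m∸[o+n]]+o m c b b+c≤m
  m∸b≡p+c : m ∸ b ≡ p + c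
  m∸b≡p+c = trans (m∸n≡[m∸[o+n]]+o m b c (subst (_≤ m) (+-comm b c) b+c≤m))
                  (cong (λ z → m ∸ z + c) (+-comm c b))
  K K′ : ℕ
  K  = (m ∸ b) C c
  K′ = (m ∸ c) C b
  K>0 : 0 < K
  K>0 = k≤n⇒nCk>0 (subst (c ≤_) (sym m∸b≡p+c) (m≤n+m c p))
  K′≤K : K′ ≤ K
  K′≤K = subst₂ (λ u v → u C b ≤ v C c) (sym m∸c≡p+b) (sym m∸b≡p+c) ([p+b]Cb≤[p+c]Cc p b≤c)
  many : ∀ B → f B ≡ true → K ≤ count (λ S → (∣ S ∣ ≡ᵇ c) ∧ avoids? S B)
  many B fB = ≤-reflexive (sym (trans (count-avoiding c B) (cong (λ z → (m ∸ z) C c) (uniform B fB))))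
  few : ∀ S → avoiders c f S ≡ true → count (λ B → f B ∧ ((∣ S ∣ ≡ᵇ c) ∧ avoids? S B)) ≤ K′
  few S S∈ = ≤-trans (count-mono _ _ sized-avoiding)
                     (≤-reflexive (trans (count-avoiding b S) (cong (λ z → (m ∸ z) C b) ∣S∣≡c)))
    where
    ∣S∣≡c = proj₁ (avoiders⁻ c f S S∈)
    sized-avoiding : ∀ B → f B ∧ ((∣ S ∣ ≡ᵇ c) ∧ avoids? S B) ≡ true → (∣ B ∣ ≡ᵇ b) ∧ avoids? B S ≡ true
    sized-avoiding B B∈ =
      let fB , S-ok = ∧-true⁻ (f B) _ B∈
          _ , S∩B≡∅ = ∧-true⁻ (∣ S ∣ ≡ᵇ c) _ S-ok
      in cong₂ _∧_ (≡ᵇ-complete (uniform B fB)) (trans (avoids?-sym B S) S∩B≡∅)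
  related : ∀ B S → f B ≡ true → (∣ S ∣ ≡ᵇ c) ∧ avoids? S B ≡ true → avoiders c f S ≡ true
  related B S fB SB = let ∣S∣≡ᵇc , S∩B≡∅ = ∧-true⁻ _ _ SB in avoiders⁺ c f S B fB S∩B≡∅ (≡ᵇ-sound ∣S∣≡ᵇc)

avoidersBound-c≡0 : ∀ {m b} (f : Subset m → Bool) → IsUniform b f → Intersecting b 0 f →
  count f ≤ count (avoiders 0 f)
avoidersBound-c≡0 {m} {b} f uniform intersecting with anySubset f in any-f
... | false = ≤-trans (≤-reflexive (¬anySubset⇒count≡0 f any-f)) z≤n
... | true  = ≤-trans (count≤1 f all-equal) (count-positive (avoiders 0 f) ⊥ ⊥-avoids)
  where
  B₀ = proj₁ (anySubset⁻ f any-f)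
  ⊥-avoids : avoiders 0 f ⊥ ≡ true
  ⊥-avoids = avoiders⁺ 0 f ⊥ B₀ (proj₂ (anySubset⁻ f any-f))
                (trans (avoids?-sym ⊥ B₀) (avoids?-⊥ B₀)) (∣⊥∣≡0 m)
  all-equal : ∀ S S′ → f S ≡ true → f S′ ≡ true → S ≡ S′
  all-equal S S′ fS fS′ = ∣∩∣-maximal⇒≡ S S′ (subst (_≤ _) (sym (uniform S fS)) b≤∣S∩S′∣)
                                              (subst (_≤ _) (sym (uniform S′ fS′)) b≤∣S∩S′∣)
    where
    b≤∣S∩S′∣ : b ≤ ∣ S ∩ S′ ∣
    b≤∣S∩S′∣ = subst (b ≤_) (+-identityʳ _) (intersecting S S′ fS fS′)

avoidersBound-step : ∀ {m} → AvoidersBound m → ∀ {b c} (f : Subset (suc m) → Bool) → c < b →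
  suc b + suc c ≤ suc m → IsUniform (suc b) f → Intersecting (suc b) (suc c) f →
  count f ≤ count (avoiders (suc c) f)
avoidersBound-step {m} bound {b} {c} f c<b (s≤s b+1+c≤m) uniform intersecting = begin
  count f                                                                 ≡⟨ count-shiftAll ⟨
  count (outside₀ F) + count (inside₀ F)                                  ≤⟨ +-mono-≤ bound₀ bound₁ ⟩
  count (avoiders c (outside₀ F)) + count (avoiders (suc c) (inside₀ F))  ≤⟨ count-avoiders-split c F true ⟩
  count (avoiders (suc c) F)                                              ≤⟨ count-avoiders-shiftAll ⟩
  count (avoiders (suc c) f)                                              ∎
  where
  open ≤-Reasoning
  F = shiftAll f
  count-shiftAll : count F ≡ count f
  count-shiftAll = shiftAll-preserves (λ G → count G ≡ count f) (λ x {G} eq → trans (count-shift x G) eq) f refl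
  count-avoiders-shiftAll : count (avoiders (suc c) F) ≤ count (avoiders (suc c) f)
  count-avoiders-shiftAll = shiftAll-preserves (λ G → count (avoiders (suc c) G) ≤ count (avoiders (suc c) f))
                              (λ x {G} le → ≤-trans (count-avoiders-shift (suc c) x G) le) f ≤-refl
  uniform-F : IsUniform (suc b) F
  uniform-F = shiftAll-preserves (IsUniform (suc b)) (λ x {G} → shift-preserves-uniform x G) f uniform
  intersecting-F : Intersecting (suc b) (suc c) F
  intersecting-F = shiftAll-preserves (Intersecting (suc b) (suc c)) (λ x {G} → shift-preserves-intersecting x G)
                     f intersecting
  bound₀ : count (outside₀ F) ≤ count (avoiders c (outside₀ F))
  bound₀ = bound (outside₀ F) (subst (_≤ m) (+-suc b c) b+1+c≤m) (λ T → uniform-F (false ∷ T))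
                 (shifted-outside₀-intersecting F (shiftAll-shifted f) c<b intersecting-F)
  bound₁ : count (inside₀ F) ≤ count (avoiders (suc c) (inside₀ F))
  bound₁ = bound (inside₀ F) b+1+c≤m (λ T T∈ → suc-injective (uniform-F (true ∷ T) T∈))
                 (inside₀-intersecting F intersecting-F)

avoidersBound : ∀ m → AvoidersBound m
avoidersBound m       {b}     {zero}  f _     uniform intersecting = avoidersBound-c≡0 f uniform intersecting
avoidersBound m       {zero}  {suc c} f b+c≤m uniform _            = avoidersBound-b≤c f z≤n b+c≤m uniform
avoidersBound zero    {suc b} {suc c} f ()    _       _
avoidersBound (suc m) {suc b} {suc c} f b+c≤m uniform intersecting with b ≤? c
... | yes b≤c = avoidersBound-b≤c f (s≤s b≤c) b+c≤m uniform
... | no  b≰c = avoidersBound-step (avoidersBound m) f (≰⇒> b≰c) b+c≤m uniform intersecting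

AvoidersBound⁺ : ℕ → Set
AvoidersBound⁺ n = ∀ {a b} (f : Subset n → Bool) → a + b ≤ n → IsUniform b f → Intersecting (suc b) a f →
  ∀ B₀ → f B₀ ≡ true → (n ∸ b) C a + count f ≤ count (avoiders a f) + 1

module SplitAtZero {n a b} (f : Subset (suc n) → Bool) (a+1+b≤n : a + suc b ≤ n)
                   (uniform : IsUniform (suc b) f) (intersecting : Intersecting (suc (suc b)) (suc a) f) where

  open ≤-Reasoning

  f₀ f₁ : Subset n → Bool
  f₀ = outside₀ f
  f₁ = inside₀ f

  bound₀ : count f₀ ≤ count (avoiders a f₀)
  bound₀ = avoidersBound n f₀ (subst (_≤ n) (+-comm a (suc b)) a+1+b≤n) (λ T → uniform (false ∷ T))
                          (outside₀-intersecting f intersecting)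

  recombine : ∀ s → count (avoiders a f₀) + (count (avoiders (suc a) (λ T → f (s ∷ T))) + 1)
                      ≤ count (avoiders (suc a) f) + 1
  recombine s = subst (_≤ count (avoiders (suc a) f) + 1)
                      (+-assoc (count (avoiders a f₀)) (count (avoiders (suc a) (λ T → f (s ∷ T)))) 1)
                      (+-monoˡ-≤ 1 (count-avoiders-split a f s))

  some-inside : AvoidersBound⁺ n → (∃ λ T₁ → f₁ T₁ ≡ true) →
    (n ∸ b) C suc a + (count f₀ + count f₁) ≤ count (avoiders (suc a) f) + 1
  some-inside bound⁺ (T₁ , fT₁) = begin
    (n ∸ b) C suc a + (count f₀ + count f₁)                     ≡⟨ x∙yz≈y∙xz _ (count f₀) (count f₁) ⟩
    count f₀ + ((n ∸ b) C suc a + count f₁)                     ≤⟨ +-mono-≤ bound₀ bound⁺₁ ⟩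
    count (avoiders a f₀) + (count (avoiders (suc a) f₁) + 1)   ≤⟨ recombine true ⟩
    count (avoiders (suc a) f) + 1                              ∎
    where
    bound⁺₁ : (n ∸ b) C suc a + count f₁ ≤ count (avoiders (suc a) f₁) + 1
    bound⁺₁ = bound⁺ f₁ (subst (_≤ n) (+-suc a b) a+1+b≤n) (λ T T∈ → suc-injective (uniform (true ∷ T) T∈))
                     (inside₀-intersecting f intersecting) T₁ fT₁

  none-inside : AvoidersBound⁺ n → anySubset f₁ ≡ false → ∀ B₀ → f B₀ ≡ true →
    (n ∸ b) C suc a + (count f₀ + count f₁) ≤ count (avoiders (suc a) f) + 1
  none-inside bound⁺ no₁ B₀ fB₀ with suc a + suc b ≤? n
  ... | yes room = begin
    (n ∸ b) C suc a + (count f₀ + count f₁)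
      ≡⟨ cong₂ (λ u v → u C suc a + (count f₀ + v)) (+-∸-assoc 1 (m+n≤o⇒n≤o (suc a) room))
                                                    (¬anySubset⇒count≡0 f₁ no₁) ⟩
    suc N C suc a + (count f₀ + 0)
      ≡⟨ trans (cong₂ _+_ (sym (nCk+nC[k+1]≡[n+1]C[k+1] N a)) (+-identityʳ (count f₀))) (+-assoc (N C a) _ _) ⟩
    N C a + (N C suc a + count f₀)
      ≤⟨ +-mono-≤ avoiding-T₀ bound⁺₀ ⟩
    count (avoiders a f₀) + (count (avoiders (suc a) f₀) + 1)
      ≤⟨ recombine false ⟩
    count (avoiders (suc a) f) + 1
      ∎
    where
    N = n ∸ suc b
    outside-member : ∀ B → f B ≡ true → f₀ (tail B) ≡ true
    outside-member (false ∷ T) fB = fB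
    outside-member (true ∷ T)  fB = contradiction (trans (sym (anySubset⁺ f₁ T fB)) no₁) λ ()
    T₀ = tail B₀
    fT₀ : f₀ T₀ ≡ true
    fT₀ = outside-member B₀ fB₀
    avoiding-T₀ : N C a ≤ count (avoiders a f₀)
    avoiding-T₀ = subst (λ z → (n ∸ z) C a ≤ count (avoiders a f₀)) (uniform _ fT₀)
                        (count-avoiding≤count-avoiders a f₀ T₀ fT₀)
    bound⁺₀ : N C suc a + count f₀ ≤ count (avoiders (suc a) f₀) + 1
    bound⁺₀ = bound⁺ f₀ room (λ T → uniform (false ∷ T)) (λ T T′ → intersecting (false ∷ T) (false ∷ T′)) T₀ fT₀
  ... | no no-room = begin
    (n ∸ b) C suc a + (count f₀ + count f₁)
      ≡⟨ cong₂ (λ u v → u C suc a + (count f₀ + v)) n∸b≡1+a (¬anySubset⇒count≡0 f₁ no₁) ⟩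
    suc a C suc a + (count f₀ + 0)
      ≡⟨ cong₂ _+_ (nCn≡1 (suc a)) (+-identityʳ (count f₀)) ⟩
    1 + count f₀
      ≤⟨ +-monoʳ-≤ 1 (≤-trans bound₀ (≤-trans (m≤m+n _ _) (count-avoiders-split a f false))) ⟩
    1 + count (avoiders (suc a) f)
      ≡⟨ +-comm 1 _ ⟩
    count (avoiders (suc a) f) + 1
      ∎
    where
    n≡a+1+b : n ≡ a + suc b
    n≡a+1+b = ≤-antisym (≤-pred (≰⇒> no-room)) a+1+b≤n
    n∸b≡1+a : n ∸ b ≡ suc a
    n∸b≡1+a = trans (cong (_∸ b) (trans n≡a+1+b (+-suc a b))) (m+n∸n≡m (suc a) b)

avoidersBound⁺ : ∀ n → AvoidersBound⁺ n
avoidersBound⁺ n {a} {zero} f _ uniform _ B₀ fB₀ =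
  +-mono-≤ (subst (λ z → (n ∸ z) C a ≤ count (avoiders a f)) (uniform B₀ fB₀)
                  (count-avoiding≤count-avoiders a f B₀ fB₀))
           (count≤1 f (λ S S′ fS fS′ → trans (∣p∣≡0⇒p≡⊥ S (uniform S fS)) (sym (∣p∣≡0⇒p≡⊥ S′ (uniform S′ fS′)))))
avoidersBound⁺ n {zero} {suc b} f _ uniform intersecting B₀ fB₀ =
  contradiction (subst (suc (suc b) ≤_) ∣B₀∩B₀∣+0≡1+b (intersecting B₀ B₀ fB₀ fB₀)) (1+n≰n {suc b})
  where
  ∣B₀∩B₀∣+0≡1+b : ∣ B₀ ∩ B₀ ∣ + 0 ≡ suc b
  ∣B₀∩B₀∣+0≡1+b = trans (+-identityʳ _) (trans (cong ∣_∣ (∩-idem B₀)) (uniform B₀ fB₀))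
avoidersBound⁺ zero    {suc a} {suc b} f () _ _ _ _
avoidersBound⁺ (suc n) {suc a} {suc b} f (s≤s a+1+b≤n) uniform intersecting B₀ fB₀
  with anySubset (inside₀ f) in any₁
... | true  = SplitAtZero.some-inside f a+1+b≤n uniform intersecting (avoidersBound⁺ n)
                (anySubset⁻ (inside₀ f) any₁)
... | false = SplitAtZero.none-inside f a+1+b≤n uniform intersecting (avoidersBound⁺ n) any₁ B₀ fB₀

-- The families of the theorem

p+r≤t⇒s+q≤r+1⇒p+q≤t∸s+1 : ∀ {p q r s t} → p + r ≤ t → s + q ≤ r + 1 → s ≤ t → p + q ≤ t ∸ s + 1
p+r≤t⇒s+q≤r+1⇒p+q≤t∸s+1 {p} {q} {r} {s} {t} p+r≤t s+q≤r+1 s≤t = begin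
  p + q       ≤⟨ m+n≤o⇒m≤o∸n (p + q) p+q+s≤t+1 ⟩
  t + 1 ∸ s   ≡⟨ +-∸-comm 1 s≤t ⟩
  t ∸ s + 1   ∎
  where
  open ≤-Reasoning
  p+q+s≤t+1 : p + q + s ≤ t + 1
  p+q+s≤t+1 = begin
    p + q + s     ≡⟨ trans (+-assoc p q s) (cong (p +_) (+-comm q s)) ⟩
    p + (s + q)   ≤⟨ +-monoʳ-≤ p s+q≤r+1 ⟩
    p + (r + 1)   ≡⟨ +-assoc p r 1 ⟨
    p + r + 1     ≤⟨ +-monoˡ-≤ 1 p+r≤t ⟩
    t + 1         ∎

facet-avoiding : ∀ {m} (B B′ : Subset m) → 0 < ∣ B ∣ → ∣ B ∩ B′ ∣ ≤ 1 →
  ∃ λ S → S ⊆ B × suc ∣ S ∣ ≡ ∣ B ∣ × avoids? S B′ ≡ true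
facet-avoiding (true ∷ B)  (true ∷ B′)  _ (s≤s ∣B∩B′∣≤0) =
  false ∷ B , out⊆ ⊆-refl , refl , ≡ᵇ-complete (n≤0⇒n≡0 ∣B∩B′∣≤0)
facet-avoiding (true ∷ B)  (false ∷ B′) _ ∣B∩B′∣≤1 with ∣ B ∩ B′ ∣ in ∣B∩B′∣
... | zero  = false ∷ B , out⊆ ⊆-refl , refl , ≡ᵇ-complete ∣B∩B′∣
... | suc _ =
  let 0<∣B∣ = ≤-trans (subst (0 <_) (sym ∣B∩B′∣) (s≤s z≤n)) (∣p∩q∣≤∣p∣ B B′)
      S , S⊆B , ∣S∣ , S∩B′≡∅ = facet-avoiding B B′ 0<∣B∣ (subst (_≤ 1) (sym ∣B∩B′∣) ∣B∩B′∣≤1)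
  in true ∷ S , s⊆s S⊆B , cong suc ∣S∣ , S∩B′≡∅
facet-avoiding (false ∷ B) (_ ∷ B′)     0<∣B∣ ∣B∩B′∣≤1 =
  let S , S⊆B , ∣S∣ , S∩B′≡∅ = facet-avoiding B B′ 0<∣B∣ ∣B∩B′∣≤1 in false ∷ S , s⊆s S⊆B , ∣S∣ , S∩B′≡∅

memberOf : ∀ {n} → Family n → Subset n → Bool
memberOf 𝒜 S = does (DecMembership._∈?_ _≟ₛ_ S (members 𝒜))

memberOf-sound : ∀ {n} (𝒜 : Family n) {S} → memberOf 𝒜 S ≡ true → S ∈F 𝒜
memberOf-sound 𝒜 {S} S∈ with DecMembership._∈?_ _≟ₛ_ S (members 𝒜)
... | yes S∈𝒜 = S∈𝒜

memberOf-complete : ∀ {n} (𝒜 : Family n) {S} → S ∈F 𝒜 → memberOf 𝒜 S ≡ true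
memberOf-complete 𝒜 {S} = dec-true (DecMembership._∈?_ _≟ₛ_ S (members 𝒜))

size≤count-memberOf : ∀ {n} (𝒜 : Family n) → size 𝒜 ≤ count (memberOf 𝒜)
size≤count-memberOf 𝒜 = length≤count (memberOf 𝒜) (members 𝒜) (unique 𝒜) (memberOf-complete 𝒜)

memberOf-uniform : ∀ {n r} (𝒜 : Family n) → Uniform r 𝒜 → IsUniform r (memberOf 𝒜)
memberOf-uniform 𝒜 uniform S S∈ = uniform (memberOf-sound 𝒜 S∈)

size+count-avoiders≤nCa : ∀ {n a} (𝒜 ℬ : Family n) → Uniform a 𝒜 → CrossIntersecting 𝒜 ℬ →
  size 𝒜 + count (avoiders a (memberOf ℬ)) ≤ n C a
size+count-avoiders≤nCa {n} {a} 𝒜 ℬ uniform cross = begin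
  size 𝒜 + count (avoiders a (memberOf ℬ))             ≤⟨ +-monoˡ-≤ _ (size≤count-memberOf 𝒜) ⟩
  count (memberOf 𝒜) + count (avoiders a (memberOf ℬ)) ≤⟨ count+count≤count _ _ _ meets-ℬ sized avoiders-sized ⟩
  count {n} (λ S → ∣ S ∣ ≡ᵇ a)                          ≡⟨ count-sized a ⟩
  n C a                                                 ∎
  where
  open ≤-Reasoning
  meets-ℬ : ∀ S → memberOf 𝒜 S ≡ true → ¬ avoiders a (memberOf ℬ) S ≡ true
  meets-ℬ S S∈𝒜 S-avoids =
    let _ , B , B∈ℬ , S∩B≡∅ = avoiders⁻ a _ S S-avoids
    in contradiction (≡ᵇ-sound S∩B≡∅)
                     (>⇒≢ (nonempty⇒∣p∣>0 (cross (memberOf-sound 𝒜 S∈𝒜) (memberOf-sound ℬ B∈ℬ))))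
  sized : ∀ S → memberOf 𝒜 S ≡ true → (∣ S ∣ ≡ᵇ a) ≡ true
  sized S S∈ = ≡ᵇ-complete (uniform (memberOf-sound 𝒜 S∈))
  avoiders-sized : ∀ S → avoiders a (memberOf ℬ) S ≡ true → (∣ S ∣ ≡ᵇ a) ≡ true
  avoiders-sized S S∈ = proj₁ (∧-true⁻ _ _ S∈)

shadow+cross⇒2≤∣B∩B′∣ : ∀ {n k} (𝒜 ℬ : Family n) → 1 ≤ k → Uniform k ℬ → CrossIntersecting 𝒜 ℬ →
  ShadowSubset k ℬ 𝒜 → ∀ {B B′} → B ∈F ℬ → B′ ∈F ℬ → 2 ≤ ∣ B ∩ B′ ∣
shadow+cross⇒2≤∣B∩B′∣ 𝒜 ℬ 1≤k uniform cross shadow {B} {B′} B∈ B′∈ with 2 ≤? ∣ B ∩ B′ ∣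
... | yes 2≤∣B∩B′∣ = 2≤∣B∩B′∣
... | no  2≰∣B∩B′∣ =
  let S , S⊆B , ∣S∣ , S∩B′≡∅ = facet-avoiding B B′ (subst (0 <_) (sym (uniform B∈)) 1≤k) (≤-pred (≰⇒> 2≰∣B∩B′∣))
      S∈𝒜 = shadow B∈ S⊆B (trans ∣S∣ (uniform B∈))
  in contradiction (≡ᵇ-sound S∩B′≡∅) (>⇒≢ (nonempty⇒∣p∣>0 (cross S∈𝒜 B′∈)))

some-member : ∀ {n} (ℬ : Family n) → ¬ members ℬ ≡ [] → ∃ λ B → B ∈F ℬ
some-member ℬ ℬ≢[] with members ℬ
... | []    = contradiction refl ℬ≢[]
... | B ∷ _ = B , here refl

[n∸k]Ca+size≤count-avoiders+1 : ∀ {n a} (𝒜 ℬ : Family n) → a + suc a ≤ n → Uniform (suc a) ℬ →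
  CrossIntersecting 𝒜 ℬ → ShadowSubset (suc a) ℬ 𝒜 → ¬ members ℬ ≡ [] →
  (n ∸ suc a) C a + size ℬ ≤ count (avoiders a (memberOf ℬ)) + 1
[n∸k]Ca+size≤count-avoiders+1 {n} {a} 𝒜 ℬ a+k≤n uniform cross shadow ℬ≢[] =
  ≤-trans (+-monoʳ-≤ ((n ∸ suc a) C a) (size≤count-memberOf ℬ))
          (avoidersBound⁺ n (memberOf ℬ) a+k≤n (memberOf-uniform ℬ uniform) intersecting
                          B₀ (memberOf-complete ℬ B₀∈ℬ))
  where
  B₀ = proj₁ (some-member ℬ ℬ≢[])
  B₀∈ℬ = proj₂ (some-member ℬ ℬ≢[])
  intersecting : Intersecting (suc (suc a)) a (memberOf ℬ)
  intersecting B B′ B∈ B′∈ = +-monoˡ-≤ a (shadow+cross⇒2≤∣B∩B′∣ 𝒜 ℬ (s≤s z≤n) uniform cross shadow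
                                                                 (memberOf-sound ℬ B∈) (memberOf-sound ℬ B′∈))

theorem2 : (k n : ℕ) → 1 ≤ k → 1 ≤ n → 2 * k ∸ 1 ≤ n →
    (𝒜 ℬ : Family n) →
    Uniform (k ∸ 1) 𝒜 → Uniform k ℬ →
    CrossIntersecting 𝒜 ℬ →
    ¬ (members ℬ ≡ []) →
    ShadowSubset k ℬ 𝒜 →
    size 𝒜 + size ℬ ≤ n C (k ∸ 1) ∸ (n ∸ k) C (k ∸ 1) + 1
theorem2 zero    n ()  _ _ _ _ _ _ _ _ _
theorem2 (suc a) n _   _ 2k-1≤n 𝒜 ℬ 𝒜-uniform ℬ-uniform cross ℬ≢[] shadow =
  p+r≤t⇒s+q≤r+1⇒p+q≤t∸s+1
    (size+count-avoiders≤nCa 𝒜 ℬ 𝒜-uniform cross)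
    ([n∸k]Ca+size≤count-avoiders+1 𝒜 ℬ a+k≤n ℬ-uniform cross shadow ℬ≢[])
    ([n∸k]Cj≤nCj {j = a} (m+n≤o⇒n≤o a a+k≤n))
  where
  a+k≤n : a + suc a ≤ n
  a+k≤n = subst (_≤ n) (cong (a +_) (+-identityʳ (suc a))) 2k-1≤n
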